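{- Let $n,k,t$ be positive integers with $t\ge n$ and $\frac{n(n+1)}{2}=k\cdot t$. If $|\rho(n,k,t)|\ge 1$, then the last symbol of $\rho(n,k,t)$ lies in $\{ge, go\}$.
   Context: The algorithm $\Pi\mathit{Solve}(n,k,t)$, on an instance $(n,k,t)$ of positive integers with $t\ge n$ and $n(n+1)/2=kt$, tests the following cases in order: case $m$: if $2k\mid n$ or $2k\mid n+1$, it solves the instance directly (meander algorithm) and stops; case $s$: else if $t\ge 2n$, it recurses on $(n-2k,\ k,\ t-2(n-k)-1)$; case $ge$: else if $t<2n$ and $t$ even, it recurses on $(t-n-1,\ 2(k-n)+t-1,\ t/2)$; case $go$: else ($t<2n$, $t$ odd) it recurses on $(t-n-1,\ k-\frac{2n-t+1}{2},\ t)$. The run sequence $\rho'(n,k,t)\in\{m,s,ge,go\}^+$ is the sequence of case symbols of the successive calls, starting with the call on $(n,k,t)$; it ends with $m$. $\rho(n,k,t)\in\{s,ge,go\}^*$ denotes $\rho'(n,k,t)$ with its last symbol removed, and $|\rho|$ its length. -}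

module Defs where

open import Data.Nat using (ℕ; suc; _+_; _*_; _<_; _≥_)
open import Data.Nat.Divisibility using (_∣_)
open import Data.Sum using (_⊎_)
open import Data.List using (List; []; _∷_)
open import Relation.Nullary using (¬_)
open import Relation.Binary.PropositionalEquality using (_≡_)

data Sym : Set where
  m s ge go : Sym

MeanderCase : ℕ → ℕ → Set
MeanderCase n k = (2 * k ∣ n) ⊎ (2 * k ∣ suc n)

Even Odd : ℕ → Set
Even t = 2 ∣ t
Odd t = ¬ (2 ∣ t)

-- The natural-number subtractions of the recursive calls are expressed by
-- equations (n' = n - 2k, t' = t - 2(n-k) - 1, etc.).
data RunSeq : ℕ → ℕ → ℕ → List Sym → Set where
  case-m  : ∀ {n k t} → MeanderCase n k → RunSeq n k t (m ∷ [])
  case-s  : ∀ {n k t n' t' r} → ¬ MeanderCase n k → t ≥ 2 * n →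
            n' + 2 * k ≡ n → t' + 2 * n + 1 ≡ t + 2 * k →
            RunSeq n' k t' r → RunSeq n k t (s ∷ r)
  case-ge : ∀ {n k t n' k' t' r} → ¬ MeanderCase n k → t < 2 * n → Even t →
            n' + n + 1 ≡ t → k' + 2 * n + 1 ≡ 2 * k + t → 2 * t' ≡ t →
            RunSeq n' k' t' r → RunSeq n k t (ge ∷ r)
  case-go : ∀ {n k t n' k' r} → ¬ MeanderCase n k → t < 2 * n → Odd t →
            n' + n + 1 ≡ t → 2 * k' + 2 * n + 1 ≡ 2 * k + t →
            RunSeq n' k' t r → RunSeq n k t (go ∷ r)

module Submission where

-- The last non-meander step of a run of ΠSolve is never an
-- s-step.  Indeed, an s-step goes from (n,k,t) to (n - 2k, k, t'), keeping k;
-- if that recursive call stopped in case m, then 2k divides n - 2k or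
-- n - 2k + 1, hence also n or n + 1, so the meander case would already have
-- applied to (n,k,t) and the s-step could not have been taken.

open import Defs
open import Data.Nat using (ℕ; _+_; _*_; _≤_; _≥_; _<_; s≤s; z≤n)
open import Data.List using (List; []; _∷_; _++_; length; last)
open import Data.Maybe using (just)
open import Data.Sum using (_⊎_; inj₁; inj₂; map)
open import Data.Empty using (⊥-elim)
open import Relation.Nullary using (¬_)
open import Data.Nat.Divisibility using (_∣_; ∣-refl; ∣m∣n⇒∣m+n)
open import Relation.Binary.PropositionalEquality using (_≡_; refl; subst)

meander-shift : ∀ {n' n k} → n' + 2 * k ≡ n → MeanderCase n' k → MeanderCase n k
meander-shift {k = k} refl = map shift shift
  where
  shift : ∀ {x} → 2 * k ∣ x → 2 * k ∣ x + 2 * k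
  shift d = ∣m∣n⇒∣m+n d ∣-refl

-- An s-step is never immediately followed by the meander case: otherwise the
-- meander case would already hold at the call that performed the s-step.
s-not-before-m : ∀ {n k t} → ¬ RunSeq n k t (s ∷ m ∷ [])
s-not-before-m {k = k} (case-s ¬meander _ n'+2k≡n _ (case-m meander)) =
  ¬meander (meander-shift {k = k} n'+2k≡n meander)

last-step : ∀ {n k t} (ρ : List Sym) → RunSeq n k t (ρ ++ m ∷ []) → 1 ≤ length ρ →
            (last ρ ≡ just ge) ⊎ (last ρ ≡ just go)
last-step (s ∷ [])     run _ = ⊥-elim (s-not-before-m run)
last-step (ge ∷ [])    _   _ = inj₁ refl
last-step (go ∷ [])    _   _ = inj₂ refl
last-step (s ∷ y ∷ ρ)  (case-s _ _ _ _ rest)       _ = last-step (y ∷ ρ) rest (s≤s z≤n)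
last-step (ge ∷ y ∷ ρ) (case-ge _ _ _ _ _ _ rest) _ = last-step (y ∷ ρ) rest (s≤s z≤n)
last-step (go ∷ y ∷ ρ) (case-go _ _ _ _ _ rest)   _ = last-step (y ∷ ρ) rest (s≤s z≤n)
last-step (m ∷ [])     ()  _
last-step (m ∷ _ ∷ _)  ()  _

corollary1 : ∀ (n k t : ℕ) → 0 < n → 0 < k → 0 < t → t ≥ n →
    n * (n + 1) ≡ 2 * (k * t) →
    ∀ (ρ : List Sym) → RunSeq n k t (ρ ++ (m ∷ [])) → 1 ≤ length ρ →
    (last ρ ≡ just ge) ⊎ (last ρ ≡ just go)
corollary1 _ _ _ _ _ _ _ _ ρ run nonempty = last-step ρ run nonempty
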